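{- For every face $F$ of $\mathcal{P}_\lambda$, the graph $\phi(F)$ is a subgraph of $\Gamma_{\mathbf{k}}$.
   Context: Fix $n>1$, a sequence $\mathbf{k}=(k_1,\dots,k_s)$ of positive integers with $\sum k_i=n$, $n_i=k_1+\dots+k_i$, $n_0=0$, and real $\lambda=(\lambda_1,\dots,\lambda_n)$ with $\lambda_1=\cdots=\lambda_{n_1}>\lambda_{n_1+1}=\cdots=\lambda_{n_2}>\cdots>\lambda_{n_{s-1}+1}=\cdots=\lambda_n$. Let $I=\{(i,j)\in\mathbb{Z}^2:i,j\ge1,\ i+j\le n\}$. $\mathcal{P}_\lambda\subset\mathbb{R}^I$ is the set of $x=(x_{i,j})$ with $x_{i,j+1}\ge x_{i,j}\ge x_{i+1,j}$ for all $(i,j)\in I$, where $x_{i,n+1-i}:=\lambda_i$. Faces of $\mathcal{P}_\lambda$ are its nonempty faces. $Q^+$ is the directed graph on $\mathbb{Z}_{\ge0}^2$ with edges $((i,j),(i,j+1))$, $((i,j),(i+1,j))$. $T_{\mathbf{k}}=\{(n_i,n-n_i):0\le i\le s\}$ and $\Gamma_{\mathbf{k}}$ is the induced subgraph of $Q^+$ on $\{(a,b):a\le c,\ b\le d\text{ for some }(c,d)\in T_{\mathbf{k}}\}$. For a face $F$, $\phi(F)$ is the subgraph of $Q^+$ whose edge set consists of: $((0,i),(0,i+1))$ and $((i,0),(i+1,0))$ for $0\le i\le n-1$; $((i-1,j),(i,j))$ for each $(i,j)\in I$ such that some point of $F$ has $x_{i,j}<x_{i,j+1}$; $((i,j-1),(i,j))$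 for each $(i,j)\in I$ such that some point of $F$ has $x_{i,j}>x_{i+1,j}$; and whose vertex set is the set of endpoints of these edges. -}

module Defs where

open import Level using (0ℓ)
open import Data.Nat as ℕ using (ℕ; zero; suc; _∸_; _≟_)
open import Data.List using (List; []; _∷_; map; concatMap; foldr)
open import Data.List.Membership.Propositional using (_∈_)
open import Data.Product using (Σ; ∃; _×_; _,_; proj₁; proj₂)
open import Data.Sum using (_⊎_)
open import Relation.Binary.PropositionalEquality using (_≡_; _≢_)
open import Relation.Binary.Core using (Rel)
open import Relation.Binary.Structures using (IsTotalOrder)
open import Algebra.Core using (Op₁; Op₂)
open import Algebra.Structures using (IsCommutativeRing)
open import Relation.Nullary using (yes; no; ¬_)

record CompleteOrderedField : Set₁ where
  infixl 6 _+_
  infixl 7 _*_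
  infix 4 _≤_ _<_
  field
    Carrier : Set
    _+_ _*_ : Op₂ Carrier
    -_ : Op₁ Carrier
    0# 1# : Carrier
    isCommutativeRing : IsCommutativeRing _≡_ _+_ _*_ -_ 0# 1#
    _≤_ : Rel Carrier 0ℓ
    isTotalOrder : IsTotalOrder _≡_ _≤_
    +-mono-≤ : ∀ {x y} z → x ≤ y → x + z ≤ y + z
    *-nonneg : ∀ {x y} → 0# ≤ x → 0# ≤ y → 0# ≤ x * y
    0≢1 : 0# ≢ 1#
    inverse : ∀ x → x ≢ 0# → ∃ λ y → x * y ≡ 1#
    complete : (P : Carrier → Set) → ∃ P →
               (∃ λ b → ∀ x → P x → x ≤ b) →
               ∃ λ s → (∀ x → P x → x ≤ s) ×
                       (∀ b → (∀ x → P x → x ≤ b) → s ≤ b)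

  _<_ : Rel Carrier 0ℓ
  x < y = x ≤ y × x ≢ y

partialSums : List ℕ → List ℕ
partialSums []       = 0 ∷ []
partialSums (k ∷ ks) = 0 ∷ map (k ℕ.+_) (partialSums ks)

Vertex : Set
Vertex = ℕ × ℕ

Tk : ℕ → List ℕ → List Vertex
Tk n ks = map (λ m → (m , n ∸ m)) (partialSums ks)

data QEdge : Vertex → Vertex → Set where
  right : ∀ i j → QEdge (i , j) (i , suc j)
  down  : ∀ i j → QEdge (i , j) (suc i , j)

ΓVertex : ℕ → List ℕ → Vertex → Set
ΓVertex n ks (a , b) = ∃ λ cd → cd ∈ Tk n ks × a ℕ.≤ proj₁ cd × b ℕ.≤ proj₂ cd

ΓEdge : ℕ → List ℕ → Vertex → Vertex → Set
ΓEdge n ks u v = QEdge u v × ΓVertex n ks u × ΓVertex n ks v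

InI : ℕ → ℕ → ℕ → Set
InI n i j = 1 ℕ.≤ i × 1 ℕ.≤ j × i ℕ.+ j ℕ.≤ n

range1 : ℕ → List ℕ
range1 zero    = []
range1 (suc m) = 1 ∷ map suc (range1 m)

Ilist : ℕ → List Vertex
Ilist n = concatMap (λ i → map (λ j → (i , j)) (range1 (n ∸ i))) (range1 (n ∸ 1))

module GT (ℝ : CompleteOrderedField) where
  open CompleteOrderedField ℝ

  Point : Set
  Point = ℕ → ℕ → Carrier

  ext : ℕ → (ℕ → Carrier) → Point → Point
  ext n lam x i j with i ℕ.+ j ≟ suc n
  ... | yes _ = lam i
  ... | no  _ = x i j

  IsAdapted : ℕ → List ℕ → (ℕ → Carrier) → Set
  IsAdapted n ks lam = ∀ a → 1 ℕ.≤ a → a ℕ.< n →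
    (a ∈ partialSums ks → lam (suc a) < lam a) ×
    (¬ (a ∈ partialSums ks) → lam (suc a) ≡ lam a)

  InP : ℕ → (ℕ → Carrier) → Point → Set
  InP n lam x = ∀ i j → InI n i j →
    ext n lam x i j ≤ ext n lam x i (suc j) ×
    ext n lam x (suc i) j ≤ ext n lam x i j

  sumK : List Carrier → Carrier
  sumK = foldr _+_ 0#

  pair : ℕ → Point → Point → Carrier
  pair n c x = sumK (map (λ ij → c (proj₁ ij) (proj₂ ij) * x (proj₁ ij) (proj₂ ij)) (Ilist n))

  IsFace : ℕ → (ℕ → Carrier) → (Point → Set) → Set
  IsFace n lam F =
    (∃ λ c → ∀ x → (F x → InP n lam x × (∀ y → InP n lam y → pair n c y ≤ pair n c x))
                 × (InP n lam x × (∀ y → InP n lam y → pair n c y ≤ pair n c x) → F x))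
    × ∃ F

  data φEdge (n : ℕ) (lam : ℕ → Carrier) (F : Point → Set) : Vertex → Vertex → Set where
    axisV : ∀ i → i ℕ.< n → φEdge n lam F (0 , i) (0 , suc i)
    axisH : ∀ i → i ℕ.< n → φEdge n lam F (i , 0) (suc i , 0)
    vert  : ∀ i j → InI n (suc i) j →
            (∃ λ x → F x × ext n lam x (suc i) j < ext n lam x (suc i) (suc j)) →
            φEdge n lam F (i , j) (suc i , j)
    horiz : ∀ i j → InI n i (suc j) →
            (∃ λ x → F x × ext n lam x (suc i) (suc j) < ext n lam x i (suc j)) →
            φEdge n lam F (i , j) (i , suc j)

  φVertex : ℕ → (ℕ → Carrier) → (Point → Set) → Vertex → Set
  φVertex n lam F v = ∃ λ u → φEdge n lam F u v ⊎ φEdge n lam F v u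

  SubgraphΓ : ℕ → List ℕ → (ℕ → Carrier) → (Point → Set) → Set
  SubgraphΓ n ks lam F =
    (∀ v → φVertex n lam F v → ΓVertex n ks v) ×
    (∀ u v → φEdge n lam F u v → ΓEdge n ks u v)

-- A point x of P_λ increases along rows and decreases down columns, and its
-- rows and columns end on the antidiagonal x_{a,n+1-a} = λ_a. Hence every entry
-- satisfies λ_{n+1-b} ≤ x_{a,b} ≤ λ_a. An edge of φ(F) ending at (a,b) comes
-- from a strict inequality between entries of x that squeezes in between these
-- bounds, so λ_{n+1-b} ≠ λ_a; as λ is constant inside the blocks of k, some
-- block boundary n_i lies in [a, n+1-b), and then (a,b) ≤ (n_i, n-n_i) ∈ T_k.
-- Γ_k is downward closed, so the source of the edge lies in Γ_k as well.
module Submission where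

open import Defs
open import Data.Nat using (ℕ; _<_)
open import Data.List using (List)
open import Data.Nat.ListAction using (sum)
open import Data.List.Relation.Unary.All using (All)
open import Relation.Binary.PropositionalEquality using (_≡_)

open import Data.Nat using (suc; _≟_; _+_; _∸_; _≤_; _≤′_; ≤′-refl; ≤′-step; z≤n; s≤s)
open import Data.Nat.Properties
open import Data.List using ([]; _∷_)
open import Data.List.Membership.Propositional using (_∈_)
open import Data.List.Membership.Propositional.Properties using (∈-map⁺)
open import Data.List.Membership.DecPropositional _≟_ using (_∈?_)
open import Data.List.Relation.Unary.Any using (here; there)
open import Data.Product using (∃; _×_; _,_; proj₁; proj₂)
open import Data.Sum using (_⊎_; inj₁; inj₂)
open import Relation.Nullary using (¬_; yes; no; contradiction)
open import Relation.Unary using (Pred; Decidable)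
open import Relation.Binary.PropositionalEquality using (_≢_; refl; sym; trans; cong; subst)
open import Relation.Binary.Structures using (IsTotalOrder)

step-constant-or-cut : ∀ {a ℓ} {A : Set a} (f : ℕ → A) {P : Pred ℕ ℓ} → Decidable P →
  ∀ {l r} → l ≤′ r → (∀ {c} → l ≤ c → c < r → ¬ P c → f (suc c) ≡ f c) →
  f r ≡ f l ⊎ ∃ λ c → P c × l ≤ c × c < r
step-constant-or-cut f P? ≤′-refl _ = inj₁ refl
step-constant-or-cut f P? (≤′-step {r} l≤′r) step
  with step-constant-or-cut f P? l≤′r (λ l≤c c<r → step l≤c (m<n⇒m<1+n c<r)) | P? r
... | inj₂ (c , Pc , l≤c , c<r) | _      = inj₂ (c , Pc , l≤c , m<n⇒m<1+n c<r)
... | inj₁ _                    | yes Pr = inj₂ (r , Pr , ≤′⇒≤ l≤′r , n<1+n r)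
... | inj₁ fr≡fl                | no ¬Pr = inj₁ (trans (step (≤′⇒≤ l≤′r) (n<1+n r) ¬Pr) fr≡fl)

0∈partialSums : ∀ ks → 0 ∈ partialSums ks
0∈partialSums []      = here refl
0∈partialSums (_ ∷ _) = here refl

sum∈partialSums : ∀ ks → sum ks ∈ partialSums ks
sum∈partialSums []       = here refl
sum∈partialSums (k ∷ ks) = there (∈-map⁺ (k +_) (sum∈partialSums ks))

ΓVertex-below : ∀ {n ks a b c} → c ∈ partialSums ks → a ≤ c → b ≤ n ∸ c → ΓVertex n ks (a , b)
ΓVertex-below {n} {c = c} c∈ a≤c b≤ = (c , n ∸ c) , ∈-map⁺ (λ m → (m , n ∸ m)) c∈ , a≤c , b≤

ΓVertex-downward : ∀ {n ks a b a′ b′} → a ≤ a′ → b ≤ b′ → ΓVertex n ks (a′ , b′) → ΓVertex n ks (a , b)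
ΓVertex-downward a≤ b≤ (t , t∈ , a′≤ , b′≤) = t , t∈ , ≤-trans a≤ a′≤ , ≤-trans b≤ b′≤

QEdge⇒ΓEdge : ∀ {n ks u v} → QEdge u v → ΓVertex n ks v → ΓEdge n ks u v
QEdge⇒ΓEdge e@(right _ _) v∈Γ = e , ΓVertex-downward ≤-refl (n≤1+n _) v∈Γ , v∈Γ
QEdge⇒ΓEdge e@(down _ _)  v∈Γ = e , ΓVertex-downward (n≤1+n _) ≤-refl v∈Γ , v∈Γ

+-suc-≤-pred : ∀ a {b n} → a + suc b ≤ suc n → a + b ≤ n
+-suc-≤-pred a {b} {n} h = ≤-pred (subst (_≤ suc n) (+-suc a b) h)

module _ (ℝ : CompleteOrderedField) (n : ℕ) (lam : ℕ → CompleteOrderedField.Carrier ℝ) where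
  open CompleteOrderedField ℝ using (Carrier; isTotalOrder) renaming (_≤_ to _≤ℝ_; _<_ to _<ℝ_)
  open IsTotalOrder isTotalOrder using () renaming (refl to ≤ℝ-refl; trans to ≤ℝ-trans; antisym to ≤ℝ-antisym)
  open GT ℝ

  ≤-<-≤⇒≢ : ∀ {u y z w} → u ≤ℝ y → y <ℝ z → z ≤ℝ w → u ≢ w
  ≤-<-≤⇒≢ u≤y (y≤z , y≢z) z≤w refl = y≢z (≤ℝ-antisym y≤z (≤ℝ-trans z≤w u≤y))

  ext-antidiagonal : ∀ x {a b} → a + b ≡ suc n → ext n lam x a b ≡ lam a
  ext-antidiagonal x {a} {b} a+b≡ with a + b ≟ suc n
  ... | yes _    = refl
  ... | no a+b≢ = contradiction a+b≡ a+b≢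

  module _ {x : Point} (x∈P : InP n lam x) where
    private
      x̂ : ℕ → ℕ → Carrier
      x̂ = ext n lam x

    row-mono : ∀ {a b b′} → 1 ≤ a → 1 ≤ b → b ≤′ b′ → a + b′ ≤ suc n → x̂ a b ≤ℝ x̂ a b′
    row-mono _ _ ≤′-refl _ = ≤ℝ-refl
    row-mono {a} 1≤a 1≤b (≤′-step {b′} b≤′b′) a+b′<1+n =
      ≤ℝ-trans (row-mono 1≤a 1≤b b≤′b′ (m≤n⇒m≤1+n a+b′≤n))
               (proj₁ (x∈P a b′ (1≤a , ≤-trans 1≤b (≤′⇒≤ b≤′b′) , a+b′≤n)))
      where a+b′≤n = +-suc-≤-pred a a+b′<1+n

    column-mono : ∀ {a a′ b} → 1 ≤ a → 1 ≤ b → a ≤′ a′ → a′ + b ≤ suc n → x̂ a′ b ≤ℝ x̂ a b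
    column-mono _ _ ≤′-refl _ = ≤ℝ-refl
    column-mono {b = b} 1≤a 1≤b (≤′-step {a′} a≤′a′) (s≤s a′+b≤n) =
      ≤ℝ-trans (proj₂ (x∈P a′ b (≤-trans 1≤a (≤′⇒≤ a≤′a′) , 1≤b , a′+b≤n)))
               (column-mono 1≤a 1≤b a≤′a′ (m≤n⇒m≤1+n a′+b≤n))

    ≤-row-end : ∀ {a b} → 1 ≤ a → 1 ≤ b → a + b ≤ suc n → x̂ a b ≤ℝ lam a
    ≤-row-end {a} {b} 1≤a 1≤b a+b≤ =
      subst (x̂ a b ≤ℝ_) (ext-antidiagonal x a+end≡)
        (row-mono 1≤a 1≤b (≤⇒≤′ (m+n≤o⇒m≤o∸n b (subst (_≤ suc n) (+-comm a b) a+b≤))) (≤-reflexive a+end≡))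
      where a+end≡ = m+[n∸m]≡n (m+n≤o⇒m≤o a a+b≤)

    column-end-≤ : ∀ {a b} → 1 ≤ a → 1 ≤ b → a + b ≤ suc n → lam (suc n ∸ b) ≤ℝ x̂ a b
    column-end-≤ {a} {b} 1≤a 1≤b a+b≤ =
      subst (_≤ℝ x̂ a b) (ext-antidiagonal x end+b≡)
        (column-mono 1≤a 1≤b (≤⇒≤′ (m+n≤o⇒m≤o∸n a a+b≤)) (≤-reflexive end+b≡))
      where end+b≡ = m∸n+n≡m (m+n≤o⇒n≤o a a+b≤)

  module _ (ks : List ℕ) (adapted : IsAdapted n ks lam) where

    ΓVertex-of-gap : ∀ {a b} → 1 ≤ a → a + suc b ≤ n → lam (n ∸ b) ≢ lam a → ΓVertex n ks (a , suc b)
    ΓVertex-of-gap {a} {b} 1≤a a+1+b≤n lam≢ with step-constant-or-cut lam (_∈? partialSums ks) (≤⇒≤′ a≤n∸b) step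
      where
        a≤n∸b = m+n≤o⇒m≤o∸n a (≤-trans (+-monoʳ-≤ a (n≤1+n b)) a+1+b≤n)
        step : ∀ {c} → a ≤ c → c < n ∸ b → ¬ c ∈ partialSums ks → lam (suc c) ≡ lam c
        step {c} a≤c c<n∸b = proj₂ (adapted c (≤-trans 1≤a a≤c) (<-≤-trans c<n∸b (m∸n≤m n b)))
    ... | inj₁ lam≡              = contradiction lam≡ lam≢
    ... | inj₂ (c , c∈ , a≤c , c<n∸b) =
      ΓVertex-below c∈ a≤c (m+n≤o⇒m≤o∸n (suc b) (subst (_≤ n) (cong suc (+-comm c b)) (m≤o∸n⇒m+n≤o (suc c) b≤n c<n∸b)))
      where b≤n = m+n≤o⇒n≤o a (≤-trans (+-monoʳ-≤ a (n≤1+n b)) a+1+b≤n)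

    φEdge-target∈Γ : ∀ {F} → (∀ x → F x → InP n lam x) → sum ks ≡ n →
                     ∀ {u v} → φEdge n lam F u v → ΓVertex n ks v
    φEdge-target∈Γ _ _ (axisV i i<n) = ΓVertex-below (0∈partialSums ks) z≤n i<n
    φEdge-target∈Γ _ Σks≡n (axisH i i<n) =
      ΓVertex-below (subst (_∈ partialSums ks) Σks≡n (sum∈partialSums ks)) i<n z≤n
    φEdge-target∈Γ F⊆P _ (vert i (suc j) (_ , _ , 1+i+1+j≤n) (x , Fx , lt)) =
      ΓVertex-of-gap (s≤s z≤n) 1+i+1+j≤n
        (≤-<-≤⇒≢ (column-end-≤ x∈P (s≤s z≤n) (s≤s z≤n) (m≤n⇒m≤1+n 1+i+1+j≤n)) lt
                 (≤-row-end x∈P (s≤s z≤n) (s≤s z≤n) (subst (_≤ suc n) (sym (+-suc (suc i) (suc j))) (s≤s 1+i+1+j≤n))))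
      where x∈P = F⊆P x Fx
    φEdge-target∈Γ F⊆P _ (horiz i j (1≤i , _ , i+1+j≤n) (x , Fx , lt)) =
      ΓVertex-of-gap 1≤i i+1+j≤n
        (≤-<-≤⇒≢ (column-end-≤ x∈P (s≤s z≤n) (s≤s z≤n) (s≤s i+1+j≤n)) lt
                 (≤-row-end x∈P 1≤i (s≤s z≤n) (m≤n⇒m≤1+n i+1+j≤n)))
      where x∈P = F⊆P x Fx

φEdge⇒QEdge : ∀ {ℝ n lam F u v} → GT.φEdge ℝ n lam F u v → QEdge u v
φEdge⇒QEdge (GT.axisV i _)      = right 0 i
φEdge⇒QEdge (GT.axisH i _)      = down i 0
φEdge⇒QEdge (GT.vert i j _ _)   = down i j
φEdge⇒QEdge (GT.horiz i j _ _)  = right i j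

lemma2p1 : (ℝ : CompleteOrderedField) →
    (n : ℕ) → 1 < n → (ks : List ℕ) → All (0 <_) ks → sum ks ≡ n →
    (lam : ℕ → CompleteOrderedField.Carrier ℝ) → GT.IsAdapted ℝ n ks lam →
    (F : GT.Point ℝ → Set) → GT.IsFace ℝ n lam F → GT.SubgraphΓ ℝ n ks lam F
lemma2p1 ℝ n _ ks _ Σks≡n lam adapted F ((_ , maximisers) , _) = vertices , edges
  where
    F⊆P : ∀ x → F x → GT.InP ℝ n lam x
    F⊆P x Fx = proj₁ (proj₁ (maximisers x) Fx)

    edges : ∀ u v → GT.φEdge ℝ n lam F u v → ΓEdge n ks u v
    edges _ _ e = QEdge⇒ΓEdge (φEdge⇒QEdge e) (φEdge-target∈Γ ℝ n lam ks adapted F⊆P Σks≡n e)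

    vertices : ∀ v → GT.φVertex ℝ n lam F v → ΓVertex n ks v
    vertices v (u , inj₁ e) = proj₂ (proj₂ (edges u v e))
    vertices v (u , inj₂ e) = proj₁ (proj₂ (edges v u e))
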